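{- Let $R$ be a commutative ring with unity and let $P\in R[x_1,\dots,x_n]$ be homogeneous. If $(J_0,\dots,J_l,d_0,\dots,d_{m-1})$ is an upper Rado functional of order $m$ for $P$, then $m=0$.
   Context: $\operatorname{supp}(P)\subseteq\mathbb{N}_0^n$ is the set of exponent vectors of monomials of $P$ with nonzero coefficient. For $\vec t\in\mathbb{N}^n$, $\alpha\cdot\vec t=\sum_j\alpha(j)t_j$. An upper Rado functional of order $m$ ($0\le m\le l$) is a tuple $(J_0,\dots,J_l,d_0,\dots,d_{m-1})$, with $J_0,\dots,J_l$ a partition of $\operatorname{supp}(P)$ into nonempty sets and $d_i\in\mathbb{N}$, such that for every $r\in\mathbb{N}$ and every finite coloring $c$ of $\mathbb{N}$ there are infinitely many $\vec t\in\mathbb{N}^n$ with $c(t_1)=\dots=c(t_n)$ for which there exist integers $M_0>\dots>M_l$ with $J_i=\{\alpha\in\operatorname{supp}(P):\alpha\cdot\vec t=M_i\}$ for all $i$, $M_i-M_m=d_i$ for $i\in\{0,\dots,m-1\}$, and (if $m<l$) $M_m-M_{m+1}\ge r$. -}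

module Defs where

open import Level using (Level; _⊔_)
open import Algebra.Bundles using (CommutativeRing)
open import Data.Nat using (ℕ; zero; suc; _*_; _<_; _≤_)
open import Data.Fin using (Fin; toℕ; fromℕ<)
open import Data.Vec using (Vec; sum; zipWith; lookup)
open import Data.List using (List)
open import Data.List.Membership.Propositional using (_∈_; _∉_)
open import Data.Integer as ℤ using (ℤ; +_)
open import Data.Product using (Σ; ∃; _×_)
open import Relation.Nullary using (¬_)
open import Relation.Binary.PropositionalEquality using (_≡_)

Exponent : ℕ → Set
Exponent n = Vec ℕ n

_·_ : ∀ {n} → Vec ℕ n → Vec ℕ n → ℕ
α · t = sum (zipWith _*_ α t)

deg : ∀ {n} → Exponent n → ℕ
deg α = sum α

record Polynomial {c ℓ} (R : CommutativeRing c ℓ) (n : ℕ) : Set (c ⊔ ℓ) where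
  open CommutativeRing R
  field
    coeff         : Exponent n → Carrier
    supportList   : List (Exponent n)
    finiteSupport : ∀ α → ¬ (coeff α ≈ 0#) → α ∈ supportList

InSupp : ∀ {c ℓ} {R : CommutativeRing c ℓ} {n} → Polynomial R n → Exponent n → Set ℓ
InSupp {R = R} P α = ¬ (CommutativeRing._≈_ R (Polynomial.coeff P α) (CommutativeRing.0# R))

IsHomogeneous : ∀ {c ℓ} {R : CommutativeRing c ℓ} {n} → Polynomial R n → Set ℓ
IsHomogeneous P = ∃ λ D → ∀ α → InSupp P α → deg α ≡ D

-- The partition J_0,…,J_l of supp(P) is encoded by a block labelling
-- b : ℕ₀ⁿ → Fin (l+1), with J_i = {α ∈ supp(P) : b α ≡ i}; the blocks must be nonempty.
IsPartitionLabelling : ∀ {c ℓ} {R : CommutativeRing c ℓ} {n} → Polynomial R n →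
                       (l : ℕ) → (Exponent n → Fin (suc l)) → Set ℓ
IsPartitionLabelling P l b = ∀ (i : Fin (suc l)) → ∃ λ α → InSupp P α × b α ≡ i

Positive : ∀ {n} → Vec ℕ n → Set
Positive t = ∀ j → 1 ≤ lookup t j

Monochromatic : ∀ {n k} → (ℕ → Fin k) → Vec ℕ n → Set
Monochromatic col t = ∀ j j' → col (lookup t j) ≡ col (lookup t j')

GoodVector : ∀ {c ℓ} {R : CommutativeRing c ℓ} {n} → Polynomial R n →
             (l m : ℕ) → (Exponent n → Fin (suc l)) → (Fin m → ℕ) →
             (r : ℕ) → Vec ℕ n → Set ℓ
GoodVector P l m b d r t =
  Σ (Fin (suc l) → ℤ) λ M →
      (∀ (i j : Fin (suc l)) → toℕ i < toℕ j → M j ℤ.< M i)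
    × (∀ α → InSupp P α → ∀ (i : Fin (suc l)) →
          (b α ≡ i → + (α · t) ≡ M i) × (+ (α · t) ≡ M i → b α ≡ i))
    × (∀ (i k : Fin (suc l)) (p : toℕ i < m) → toℕ k ≡ m →
          M i ℤ.- M k ≡ + d (fromℕ< p))
    × (∀ (k j : Fin (suc l)) → toℕ k ≡ m → toℕ j ≡ suc m →
          + r ℤ.≤ M k ℤ.- M j)

IsUpperRadoFunctional : ∀ {c ℓ} {R : CommutativeRing c ℓ} {n} → Polynomial R n →
                        (l m : ℕ) → (Exponent n → Fin (suc l)) → (Fin m → ℕ) → Set ℓ
IsUpperRadoFunctional {n = n} P l m b d =
    m ≤ l
  × IsPartitionLabelling P l b
  × (∀ i → 1 ≤ d i)
  × (∀ (r : ℕ) → 1 ≤ r → ∀ (k : ℕ) (col : ℕ → Fin k) →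
       -- infinitely many t: for every finite list of vectors there is a good t outside it
       ∀ (L : List (Vec ℕ n)) → ∃ λ t →
         t ∉ L × Positive t × Monochromatic col t × GoodVector P l m b d r t)

{-# OPTIONS --safe #-}
module Submission where

-- Colour ℕ by residues modulo q = d₀ + 1. If all entries of t are congruent to x modulo q,
-- then α · t ≡ deg α · x (mod q), so by homogeneity every α ∈ supp P gives the same
-- residue of α · t. An upper Rado functional of order m ≥ 1 would instead provide, for a
-- monochromatic t, some α ∈ J₀ and β ∈ J_m with α · t = β · t + d₀, where 0 < d₀ < q.

open import Defs
open import Algebra.Bundles using (CommutativeRing)
open import Data.Nat using (ℕ; suc; zero; _+_; _*_; _%_; NonZero; _<_; z≤n; s≤s; >-nonZero)
open import Data.Nat.Properties using (+-cancelˡ-≡; +-assoc; +-comm; *-distribʳ-+; <⇒≱; n<1+n)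
open import Data.Nat.DivMod using (_mod_; m%n<n; m≡m%n+[m/n]*n; %-distribˡ-+; %-distribˡ-*; _/_)
open import Data.Nat.Divisibility using (_∣_; ∣m+n∣m⇒∣n; n∣m*n; ∣⇒≤)
open import Data.Fin using (Fin; zero; suc; toℕ; fromℕ<)
open import Data.Fin.Properties using (toℕ-fromℕ<)
open import Data.Vec using (Vec; []; _∷_; lookup)
open import Data.List using ([])
open import Data.Product using (_,_; proj₁)
open import Data.Empty using (⊥-elim)
open import Data.Integer as ℤ using (+_)
open import Data.Integer.Properties using (+-injective; +-0-abelianGroup)
open import Algebra.Properties.AbelianGroup +-0-abelianGroup using (//-rightDividesˡ)
open import Relation.Binary.PropositionalEquality

+m-+n≡+k⇒m≡k+n : ∀ {m n k} → + m ℤ.- + n ≡ + k → m ≡ k + n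
+m-+n≡+k⇒m≡k+n {m} {n} {k} m-n≡k = +-injective (begin
  + m                    ≡⟨ //-rightDividesˡ (+ n) (+ m) ⟨
  (+ m ℤ.- + n) ℤ.+ + n  ≡⟨ cong (ℤ._+ + n) m-n≡k ⟩
  + k ℤ.+ + n            ∎)
  where open ≡-Reasoning

module _ {q : ℕ} .{{_ : NonZero q}} where

  [m+n]%q≡m%q⇒q∣n : ∀ m n → (m + n) % q ≡ m % q → q ∣ n
  [m+n]%q≡m%q⇒q∣n m n eq = ∣m+n∣m⇒∣n q∣[m/q]*q+n (n∣m*n (m / q))
    where
    open ≡-Reasoning
    [m/q]*q+n≡[m+n]/q*q : m / q * q + n ≡ (m + n) / q * q
    [m/q]*q+n≡[m+n]/q*q = +-cancelˡ-≡ (m % q) _ _ (begin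
      m % q + (m / q * q + n)        ≡⟨ +-assoc (m % q) _ n ⟨
      m % q + m / q * q + n          ≡⟨ cong (_+ n) (m≡m%n+[m/n]*n m q) ⟨
      m + n                          ≡⟨ m≡m%n+[m/n]*n (m + n) q ⟩
      (m + n) % q + (m + n) / q * q  ≡⟨ cong (_+ (m + n) / q * q) eq ⟩
      m % q + (m + n) / q * q        ∎)
    q∣[m/q]*q+n : q ∣ m / q * q + n
    q∣[m/q]*q+n = subst (q ∣_) (sym [m/q]*q+n≡[m+n]/q*q) (n∣m*n ((m + n) / q))

  ·-%-uniform : ∀ {n} (α t : Vec ℕ n) x → (∀ j → lookup t j % q ≡ x % q) →
                (α · t) % q ≡ (deg α * x) % q
  ·-%-uniform [] [] x _ = refl
  ·-%-uniform (a ∷ α) (s ∷ t) x t≡x = begin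
    (a * s + α · t) % q                 ≡⟨ %-distribˡ-+ (a * s) (α · t) q ⟩
    ((a * s) % q + (α · t) % q) % q     ≡⟨ cong₂ (λ u v → (u + v) % q) as≡ax α·t≡ ⟩
    ((a * x) % q + (deg α * x) % q) % q ≡⟨ %-distribˡ-+ (a * x) (deg α * x) q ⟨
    (a * x + deg α * x) % q             ≡⟨ cong (_% q) (*-distribʳ-+ x a (deg α)) ⟨
    ((a + deg α) * x) % q               ∎
    where
    open ≡-Reasoning
    α·t≡ : (α · t) % q ≡ (deg α * x) % q
    α·t≡ = ·-%-uniform α t x (λ j → t≡x (suc j))
    as≡ax : (a * s) % q ≡ (a * x) % q
    as≡ax = begin
      (a * s) % q             ≡⟨ %-distribˡ-* a s q ⟩
      ((a % q) * (s % q)) % q ≡⟨ cong (λ u → ((a % q) * u) % q) (t≡x zero) ⟩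
      ((a % q) * (x % q)) % q ≡⟨ %-distribˡ-* a x q ⟨
      (a * x) % q             ∎

  ·-%-deg : ∀ {n} (α β t : Vec ℕ n) → deg α ≡ deg β →
            (∀ j j' → lookup t j % q ≡ lookup t j' % q) → (α · t) % q ≡ (β · t) % q
  ·-%-deg [] [] [] _ _ = refl
  ·-%-deg α β t@(x ∷ _) degα≡degβ t≡t = begin
    (α · t) % q     ≡⟨ ·-%-uniform α t x (λ j → t≡t j zero) ⟩
    (deg α * x) % q ≡⟨ cong (λ e → (e * x) % q) degα≡degβ ⟩
    (deg β * x) % q ≡⟨ ·-%-uniform β t x (λ j → t≡t j zero) ⟨
    (β · t) % q     ∎
    where open ≡-Reasoning

  Monochromatic-mod : ∀ {n} (t : Vec ℕ n) → Monochromatic (_mod q) t →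
                      ∀ j j' → lookup t j % q ≡ lookup t j' % q
  Monochromatic-mod t mono j j' = begin
    lookup t j % q              ≡⟨ toℕ-fromℕ< (m%n<n (lookup t j) q) ⟨
    toℕ (lookup t j mod q)      ≡⟨ cong toℕ (mono j j') ⟩
    toℕ (lookup t j' mod q)     ≡⟨ toℕ-fromℕ< (m%n<n (lookup t j') q) ⟩
    lookup t j' % q             ∎
    where open ≡-Reasoning

GoodVector-gap : ∀ {c ℓ} {R : CommutativeRing c ℓ} {n} (P : Polynomial R n)
                 {l m b d r t} → GoodVector P l m b d r t →
                 ∀ {i k} (i<m : toℕ i < m) → toℕ k ≡ m →
                 ∀ {α β} → InSupp P α → b α ≡ i → InSupp P β → b β ≡ k →
                 α · t ≡ d (fromℕ< i<m) + β · t
GoodVector-gap P {t = t} (M , _ , blocks , gaps , _) i<m k≡m {α} {β} α∈P α∈Jᵢ β∈P β∈Jₖ =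
  +m-+n≡+k⇒m≡k+n (begin
    + (α · t) ℤ.- + (β · t)  ≡⟨ cong₂ ℤ._-_ (proj₁ (blocks _ α∈P _) α∈Jᵢ) (proj₁ (blocks _ β∈P _) β∈Jₖ) ⟩
    M _ ℤ.- M _              ≡⟨ gaps _ _ i<m k≡m ⟩
    + _                      ∎)
  where open ≡-Reasoning

corollary2p12 : ∀ {c ℓ} (R : CommutativeRing c ℓ) (n : ℕ) (P : Polynomial R n) →
                IsHomogeneous P →
                ∀ (l m : ℕ) (b : Exponent n → Fin (suc l)) (d : Fin m → ℕ) →
                IsUpperRadoFunctional P l m b d → m ≡ 0
corollary2p12 _ _ _ _ _ zero _ _ _ = refl
corollary2p12 _ _ P (_ , homogeneous) _ (suc _) _ d (m≤l , blocks , d≥1 , radoSets)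
  with radoSets 1 (s≤s z≤n) (suc (d zero)) (_mod suc (d zero)) []
     | blocks zero | blocks (fromℕ< (s≤s m≤l))
... | t , _ , _ , mono , good | α , α∈P , α∈J₀ | β , β∈P , β∈Jₘ =
  ⊥-elim (<⇒≱ (n<1+n (d zero)) (∣⇒≤ {{>-nonZero (d≥1 zero)}} q∣d₀))
  where
  open ≡-Reasoning
  α·t≡d₀+β·t : α · t ≡ d zero + β · t
  α·t≡d₀+β·t = GoodVector-gap P {d = d} good (s≤s z≤n) (toℕ-fromℕ< (s≤s m≤l)) α∈P α∈J₀ β∈P β∈Jₘ
  q∣d₀ : suc (d zero) ∣ d zero
  q∣d₀ = [m+n]%q≡m%q⇒q∣n (β · t) (d zero) (begin
    (β · t + d zero) % suc (d zero)  ≡⟨ cong (_% suc (d zero)) (trans (+-comm _ (d zero)) (sym α·t≡d₀+β·t)) ⟩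
    (α · t) % suc (d zero)           ≡⟨ ·-%-deg α β t (trans (homogeneous α α∈P) (sym (homogeneous β β∈P)))
                                                       (Monochromatic-mod t mono) ⟩
    (β · t) % suc (d zero)           ∎)
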